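{- Let $k$ be a positive integer. For a partition $\pi$ with largest part $\ell(\pi)$, let $\nu_{d,<k}(\pi)$ be the number of integers $i$ with $1\le i\le \ell(\pi)$ that occur as a part of $\pi$ fewer than $k$ times (the empty partition has $\nu_{d,<k}=0$). For $n\ge0$ let $\nu_{D,<k}(n)=\sum_{\pi}\nu_{d,<k}(\pi)$, the sum over all partitions $\pi$ of $n$. Then, for $|q|<1$, \[ \sum_{n=0}^{\infty}\nu_{D,<k}(n)q^n=\frac{1}{(q;q)_{\infty}}\sum_{\substack{n=1\\ n \neq k}}^{\infty}\frac{q^n}{1-q^n}. \] Consequently, for every $n\ge0$, $\nu_{D,<k}(n)$ equals the total number of parts different from $k$ in all the partitions of $n$ (parts counted with multiplicity).
   Context: Notation: $(q;q)_\infty=\prod_{i\ge1}(1-q^{i})$. -}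

module Defs where

open import Data.Nat using (ℕ; zero; suc; _+_; _*_; _∸_; _⊔_; _≤?_; _<?_; _≟_)
open import Data.Nat.Divisibility using (_∣?_)
open import Data.Integer as ℤ using (ℤ; +_)
open import Data.List using (List; []; _∷_; [_]; _++_; map; concatMap; filter; upTo; length; foldr; replicate)
open import Data.Nat.ListAction using (sum)
open import Data.Bool using (if_then_else_)
open import Relation.Nullary using (¬?; does)
open import Relation.Nullary.Decidable using (_×-dec_)

-- Partitions, as nonincreasing lists of positive parts.

-- partitionsBounded m n : all partitions of n with every part ≤ m
-- (choose the multiplicity c of the part m, then recurse on m - 1).
partitionsBounded : ℕ → ℕ → List (List ℕ)
partitionsBounded zero zero    = [ [] ]
partitionsBounded zero (suc _) = []
partitionsBounded (suc m) n =
  concatMap (λ c → map (replicate c (suc m) ++_) (partitionsBounded m (n ∸ c * suc m)))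
            (filter (λ c → c * suc m ≤? n) (upTo (suc n)))

partitions : ℕ → List (List ℕ)
partitions n = partitionsBounded n n

largestPart : List ℕ → ℕ
largestPart = foldr _⊔_ 0

mult : ℕ → List ℕ → ℕ
mult i π = length (filter (λ x → x ≟ i) π)

νd< : ℕ → List ℕ → ℕ
νd< k π = length (filter (λ i → mult i π <? k) (map suc (upTo (largestPart π))))

νD< : ℕ → ℕ → ℕ
νD< k n = sum (map (νd< k) (partitions n))

partsNot : ℕ → ℕ → ℕ
partsNot k n = sum (map (λ π → length (filter (λ x → ¬? (x ≟ k)) π)) (partitions n))

-- Formal power series over ℤ, as coefficient sequences.

Series : Set
Series = ℕ → ℤ

sumℤ : List ℤ → ℤ
sumℤ = foldr ℤ._+_ (+ 0)

_⊛_ : Series → Series → Series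
(a ⊛ b) n = sumℤ (map (λ j → a j ℤ.* b (n ∸ j)) (upTo (suc n)))

oneS : Series
oneS zero    = + 1
oneS (suc _) = + 0

-- the polynomial 1 - q^i   (used with i ≥ 1)
oneMinusQ : ℕ → Series
oneMinusQ i zero = + 1
oneMinusQ i (suc n) = if does (suc n ≟ i) then ℤ.-[1+ 0 ] else + 0

finProd : ℕ → Series
finProd zero    = oneS
finProd (suc N) = finProd N ⊛ oneMinusQ (suc N)

-- (q;q)_∞ : its n-th coefficient equals that of ∏_{i=1}^{n} (1 - q^i)
qqInf : Series
qqInf n = finProd n n

νDSeries : ℕ → Series
νDSeries k n = + νD< k n

-- Σ_{m ≥ 1, m ≠ k} q^m/(1 - q^m) = Σ_{m ≥ 1, m ≠ k} Σ_{r ≥ 1} q^{m r};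
-- coefficient of q^j is #{ m : 1 ≤ m, m ≠ k, m ∣ j } (0 for j = 0).
lambertNot : ℕ → Series
lambertNot k j = + length (filter (λ m → ¬? (m ≟ k) ×-dec (m ∣? j)) (map suc (upTo j)))

module Submission where

open import Defs
open import Algebra.Bundles using (CommutativeSemigroup)
open import Algebra.Structures using (IsCommutativeMonoid)
open import Level using (0ℓ)
open import Data.Nat using (ℕ; _≤_)
open import Data.Product using (_×_; _,_)
open import Relation.Binary.PropositionalEquality

-- For a partition π of n with largest part ℓ, every 1 ≤ i ≤ ℓ occurs either fewer than k times
-- or at least k times, so ν_{d,<k}(π) = ℓ − #{i : i occurs at least k times in π}; likewise the
-- parts of π different from k number #parts(π) − (multiplicity of k in π). Summed over π ⊢ n,
-- both corrections equal ∑_{i ≥ 1} p(n − ki) (remove k copies of i, resp. i copies of k), and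
-- ∑ ℓ(π) = ∑ #parts(π), because for every i the partitions of n with largest part ≤ i and those
-- with at most i parts are those fitting in an i × n, resp. n × i, box, and the number of
-- partitions of n fitting in a box is symmetric in its two sides. Hence ν_{D,<k}(n) is the number
-- of parts different from k.
-- Counting those parts by value m ≠ k and by r ≤ multiplicity gives
-- ν_{D,<k}(n) = ∑_{m ≠ k} ∑_{r ≥ 1} p(n − rm), i.e. ∑ ν_{D,<k}(n) qⁿ = (∑_{m ≠ k} qᵐ/(1 − qᵐ)) P(q),
-- and (q;q)_∞ P(q) = 1 follows from p_M(n) = p_{M−1}(n) + p_M(n − M) for partitions into parts ≤ M.

module CommutativeMonoidSums
  {A : Set} {_∙_ : A → A → A} {ε : A} (isCM : IsCommutativeMonoid _≡_ _∙_ ε) where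

  open IsCommutativeMonoid isCM using (assoc; comm; identityˡ; identityʳ; isCommutativeSemigroup)
  private
    commutativeSemigroup : CommutativeSemigroup 0ℓ 0ℓ
    commutativeSemigroup = record { isCommutativeSemigroup = isCommutativeSemigroup }

  open import Algebra.Properties.CommutativeSemigroup commutativeSemigroup using (interchange)
  open import Data.Bool using (true; false; if_then_else_)
  open import Data.List using (List; []; _∷_; _++_; map; foldr; applyUpTo)
  open import Data.List.Relation.Unary.All using (All; []; _∷_)
  open import Data.Nat using (zero; suc; _+_; _*_; _∸_; _<_; z≤n; s≤s; _≤?_; _≟_; >-nonZero)
  open import Data.Nat.Properties
    using (<⇒≱; <-≤-trans; m≤n*m; m≤m*n; ≤-trans; m≤m+n; m+[n∸m]≡n; m+n∸m≡n; ∸-+-assoc; +-comm; +-monoʳ-≤;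
           ∸-monoˡ-≤; +-monoʳ-<; suc-injective)
  open import Function using (_∘_)
  open import Relation.Nullary using (¬_; yes; no; does; contradiction)

  ∑< : ℕ → (ℕ → A) → A
  ∑< zero    f = ε
  ∑< (suc n) f = f 0 ∙ ∑< n (f ∘ suc)

  infixl 10 ∑< ∑∈
  syntax ∑< n (λ i → e) = ∑[ i < n ] e

  ∑∈ : {X : Set} → List X → (X → A) → A
  ∑∈ xs f = foldr _∙_ ε (map f xs)

  syntax ∑∈ xs (λ x → e) = ∑[ x ∈ xs ] e

  ∑<-cong : ∀ n {f g : ℕ → A} → (∀ i → i < n → f i ≡ g i) → ∑< n f ≡ ∑< n g
  ∑<-cong zero    f≡g = refl
  ∑<-cong (suc n) f≡g = cong₂ _∙_ (f≡g 0 (s≤s z≤n)) (∑<-cong n (λ i i<n → f≡g (suc i) (s≤s i<n)))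

  ∑<-zero : ∀ n {f : ℕ → A} → (∀ i → i < n → f i ≡ ε) → ∑< n f ≡ ε
  ∑<-zero n f≡ε = trans (∑<-cong n f≡ε) (const-ε n)
    where
      const-ε : ∀ n → ∑< n (λ _ → ε) ≡ ε
      const-ε zero    = refl
      const-ε (suc n) = trans (cong (ε ∙_) (const-ε n)) (identityˡ ε)

  ∑<-distrib : ∀ n (f g : ℕ → A) → ∑[ i < n ] (f i ∙ g i) ≡ ∑< n f ∙ ∑< n g
  ∑<-distrib zero    f g = sym (identityˡ ε)
  ∑<-distrib (suc n) f g =
    trans (cong ((f 0 ∙ g 0) ∙_) (∑<-distrib n (f ∘ suc) (g ∘ suc))) (interchange _ _ _ _)

  ∑<-+ : ∀ m n (f : ℕ → A) → ∑< (m + n) f ≡ ∑< m f ∙ (∑[ i < n ] f (m + i))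
  ∑<-+ zero    n f = sym (identityˡ _)
  ∑<-+ (suc m) n f = trans (cong (f 0 ∙_) (∑<-+ m n (f ∘ suc))) (sym (assoc _ _ _))

  ∑<-truncate : ∀ {m n} (f : ℕ → A) → m ≤ n → (∀ i → m ≤ i → i < n → f i ≡ ε) → ∑< n f ≡ ∑< m f
  ∑<-truncate {m} {n} f m≤n tail≡ε = begin
    ∑< n f                                ≡⟨ cong (λ k → ∑< k f) (sym (m+[n∸m]≡n m≤n)) ⟩
    ∑< (m + (n ∸ m)) f                    ≡⟨ ∑<-+ m (n ∸ m) f ⟩
    ∑< m f ∙ (∑[ i < n ∸ m ] f (m + i))   ≡⟨ cong (∑< m f ∙_) (∑<-zero (n ∸ m) tail-zero) ⟩
    ∑< m f ∙ ε                            ≡⟨ identityʳ _ ⟩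
    ∑< m f                                ∎
    where
      open ≡-Reasoning
      tail-zero : ∀ i → i < n ∸ m → f (m + i) ≡ ε
      tail-zero i i<n∸m = tail≡ε (m + i) (m≤m+n m i)
        (subst (m + i <_) (m+[n∸m]≡n m≤n) (+-monoʳ-< m i<n∸m))

  ∑<-suc : ∀ n (f : ℕ → A) → ∑< (suc n) f ≡ ∑< n f ∙ f n
  ∑<-suc zero    f = comm (f 0) ε
  ∑<-suc (suc n) f = trans (cong (f 0 ∙_) (∑<-suc n (f ∘ suc))) (sym (assoc _ _ _))

  ∑<-reverse : ∀ n (f : ℕ → A) → ∑< (suc n) f ≡ ∑[ i < suc n ] f (n ∸ i)
  ∑<-reverse zero    f = refl
  ∑<-reverse (suc n) f = begin
    ∑< (suc (suc n)) f                         ≡⟨ ∑<-suc (suc n) f ⟩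
    ∑< (suc n) f ∙ f (suc n)                   ≡⟨ cong (_∙ f (suc n)) (∑<-reverse n f) ⟩
    (∑[ i < suc n ] f (n ∸ i)) ∙ f (suc n)   ≡⟨ comm _ _ ⟩
    ∑[ i < suc (suc n) ] f (suc n ∸ i)         ∎
    where open ≡-Reasoning

  ∑<-single : ∀ n d (f : ℕ → A) → d < n → (∀ i → i ≢ d → f i ≡ ε) → ∑< n f ≡ f d
  ∑<-single (suc n) zero f _ others≡ε =
    trans (cong (f 0 ∙_) (∑<-zero n (λ i _ → others≡ε (suc i) λ ()))) (identityʳ _)
  ∑<-single (suc n) (suc d) f (s≤s d<n) others≡ε =
    trans (cong₂ _∙_ (others≡ε 0 λ ())
                     (∑<-single n d (f ∘ suc) d<n (λ i i≢d → others≡ε (suc i) (i≢d ∘ suc-injective))))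
          (identityˡ _)

  ∑∈-applyUpTo : ∀ (f : ℕ → A) (g : ℕ → ℕ) n → ∑[ i ∈ applyUpTo g n ] f i ≡ ∑[ i < n ] f (g i)
  ∑∈-applyUpTo f g zero    = refl
  ∑∈-applyUpTo f g (suc n) = cong (f (g 0) ∙_) (∑∈-applyUpTo f (g ∘ suc) n)

  ∑∈-++ : ∀ {X : Set} (f : X → A) xs ys → ∑∈ (xs ++ ys) f ≡ ∑∈ xs f ∙ ∑∈ ys f
  ∑∈-++ f []       ys = sym (identityˡ _)
  ∑∈-++ f (x ∷ xs) ys = trans (cong (f x ∙_) (∑∈-++ f xs ys)) (sym (assoc _ _ _))

  ∑∈-map : ∀ {X Y : Set} (f : Y → A) (g : X → Y) xs → ∑∈ (map g xs) f ≡ ∑∈ xs (f ∘ g)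
  ∑∈-map f g []       = refl
  ∑∈-map f g (x ∷ xs) = cong (f (g x) ∙_) (∑∈-map f g xs)

  ∑∈-cong-local : ∀ {X : Set} {P : X → Set} {f g : X → A} {xs} →
                  All P xs → (∀ x → P x → f x ≡ g x) → ∑∈ xs f ≡ ∑∈ xs g
  ∑∈-cong-local []         f≡g = refl
  ∑∈-cong-local (px ∷ pxs) f≡g = cong₂ _∙_ (f≡g _ px) (∑∈-cong-local pxs f≡g)

  ∑∈-cong : ∀ {X : Set} {f g : X → A} xs → (∀ x → f x ≡ g x) → ∑∈ xs f ≡ ∑∈ xs g
  ∑∈-cong []       f≡g = refl
  ∑∈-cong (x ∷ xs) f≡g = cong₂ _∙_ (f≡g x) (∑∈-cong xs f≡g)

  ∑∈-zero : ∀ {X : Set} {f : X → A} xs → (∀ x → f x ≡ ε) → ∑∈ xs f ≡ ε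
  ∑∈-zero []       f≡ε = refl
  ∑∈-zero (x ∷ xs) f≡ε = trans (cong₂ _∙_ (f≡ε x) (∑∈-zero xs f≡ε)) (identityˡ ε)

  ∑∈-distrib : ∀ {X : Set} (f g : X → A) xs → ∑[ x ∈ xs ] (f x ∙ g x) ≡ ∑∈ xs f ∙ ∑∈ xs g
  ∑∈-distrib f g []       = sym (identityˡ ε)
  ∑∈-distrib f g (x ∷ xs) =
    trans (cong ((f x ∙ g x) ∙_) (∑∈-distrib f g xs)) (interchange _ _ _ _)

  ∑∈-∑<-comm : ∀ {X : Set} (f : X → ℕ → A) n xs → ∑[ x ∈ xs ] ∑< n (f x) ≡ ∑[ i < n ] ∑[ x ∈ xs ] f x i
  ∑∈-∑<-comm f n []       = sym (∑<-zero n (λ _ _ → refl))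
  ∑∈-∑<-comm f n (x ∷ xs) =
    trans (cong (∑< n (f x) ∙_) (∑∈-∑<-comm f n xs)) (sym (∑<-distrib n (f x) _))

  -- shift s f is the coefficient sequence of qˢ · f.
  shift : ℕ → (ℕ → A) → ℕ → A
  shift s f n with s ≤? n
  ... | yes _ = f (n ∸ s)
  ... | no  _ = ε

  shift-≤ : ∀ {s n} (f : ℕ → A) → s ≤ n → shift s f n ≡ f (n ∸ s)
  shift-≤ {s} {n} f s≤n with s ≤? n
  ... | yes _   = refl
  ... | no  s≰n = contradiction s≤n s≰n

  shift-≰ : ∀ {s n} (f : ℕ → A) → ¬ s ≤ n → shift s f n ≡ ε
  shift-≰ {s} {n} f s≰n with s ≤? n
  ... | yes s≤n = contradiction s≤n s≰n
  ... | no  _   = refl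

  shift-cong : ∀ s n {f g : ℕ → A} → (s ≤ n → f (n ∸ s) ≡ g (n ∸ s)) → shift s f n ≡ shift s g n
  shift-cong s n f≡g with s ≤? n
  ... | yes s≤n = f≡g s≤n
  ... | no  _   = refl

  shift-ε : ∀ s n {f : ℕ → A} → (∀ x → f x ≡ ε) → shift s f n ≡ ε
  shift-ε s n f≡ε with s ≤? n
  ... | yes _ = f≡ε (n ∸ s)
  ... | no  _ = refl

  shift-zero : ∀ (f : ℕ → A) n → shift 0 f n ≡ f n
  shift-zero f n = shift-≤ f z≤n

  shift-distrib : ∀ s (f g : ℕ → A) n → shift s (λ x → f x ∙ g x) n ≡ shift s f n ∙ shift s g n
  shift-distrib s f g n with s ≤? n
  ... | yes _ = refl
  ... | no  _ = sym (identityˡ ε)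

  shift-shift : ∀ a b (f : ℕ → A) n → shift a (shift b f) n ≡ shift (a + b) f n
  shift-shift a b f n with a ≤? n
  ... | no a≰n = sym (shift-≰ f (λ a+b≤n → a≰n (≤-trans (m≤m+n a b) a+b≤n)))
  ... | yes a≤n with b ≤? n ∸ a
  ...   | yes b≤n∸a = sym (trans (shift-≤ f (subst (a + b ≤_) (m+[n∸m]≡n a≤n) (+-monoʳ-≤ a b≤n∸a)))
                                 (cong f (sym (∸-+-assoc n a b))))
  ...   | no b≰n∸a = sym (shift-≰ f (λ a+b≤n → b≰n∸a (subst (_≤ n ∸ a) (m+n∸m≡n a b) (∸-monoˡ-≤ a a+b≤n))))

  shift-comm : ∀ a b (f : ℕ → A) n → shift a (shift b f) n ≡ shift b (shift a f) n
  shift-comm a b f n = begin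
    shift a (shift b f) n  ≡⟨ shift-shift a b f n ⟩
    shift (a + b) f n      ≡⟨ cong (λ s → shift s f n) (+-comm a b) ⟩
    shift (b + a) f n      ≡⟨ shift-shift b a f n ⟨
    shift b (shift a f) n  ∎
    where open ≡-Reasoning

  -- the sum over 1 ≤ m ≤ n with m ≢ k
  ∑≢ : ℕ → ℕ → (ℕ → A) → A
  ∑≢ k n f = ∑[ i < n ] (if does (suc i ≟ k) then ε else f (suc i))

  ∑≢-cong : ∀ k n {f g : ℕ → A} → (∀ m → 0 < m → m ≤ n → f m ≡ g m) → ∑≢ k n f ≡ ∑≢ k n g
  ∑≢-cong k n f≡g = ∑<-cong n (λ i i<n → cong (if does (suc i ≟ k) then ε else_) (f≡g (suc i) (s≤s z≤n) i<n))

  ∑≢-truncate : ∀ k {m n} (f : ℕ → A) → m ≤ n → (∀ i → m < i → i ≤ n → f i ≡ ε) → ∑≢ k n f ≡ ∑≢ k m f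
  ∑≢-truncate k f m≤n tail≡ε = ∑<-truncate _ m≤n (λ i m≤i i<n → unless-ε (tail≡ε (suc i) (s≤s m≤i) i<n))
    where
      unless-ε : ∀ {b x} → x ≡ ε → (if b then ε else x) ≡ ε
      unless-ε {true}  _    = refl
      unless-ε {false} x≡ε = x≡ε

  ∑∈-∑≢-comm : ∀ {X : Set} k n (f : X → ℕ → A) xs → ∑[ x ∈ xs ] ∑≢ k n (f x) ≡ ∑≢ k n (λ m → ∑[ x ∈ xs ] f x m)
  ∑∈-∑≢-comm {X} k n f xs =
    trans (∑∈-∑<-comm (λ x i → if does (suc i ≟ k) then ε else f x (suc i)) n xs)
          (∑<-cong n (λ i _ → ∑∈-unless (does (suc i ≟ k)) (λ x → f x (suc i))))
    where
      ∑∈-unless : ∀ b (g : X → A) → ∑[ x ∈ xs ] (if b then ε else g x) ≡ (if b then ε else ∑∈ xs g)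
      ∑∈-unless true  g = ∑∈-zero xs (λ _ → refl)
      ∑∈-unless false g = refl

  -- Λ k N f is the truncation at N of (∑_{m ≥ 1, m ≢ k} q^m / (1 - q^m)) · f.
  Λ : ℕ → ℕ → (ℕ → A) → ℕ → A
  Λ k N f x = ∑≢ k N (λ m → ∑[ r < N ] shift (suc r * m) f x)

  Λ-cong : ∀ k N {f g : ℕ → A} → (∀ y → f y ≡ g y) → ∀ x → Λ k N f x ≡ Λ k N g x
  Λ-cong k N {f} {g} f≡g x =
    ∑≢-cong k N (λ m _ _ → ∑<-cong N (λ r _ → shift-cong (suc r * m) x {f} {g} (λ _ → f≡g _)))

  Λ-truncate : ∀ k {N x} (f : ℕ → A) → x ≤ N → Λ k N f x ≡ Λ k x f x
  Λ-truncate k {N} {x} f x≤N = begin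
    ∑≢ k N (λ m → ∑[ r < N ] shift (suc r * m) f x)
      ≡⟨ ∑≢-truncate k (λ m → ∑[ r < N ] shift (suc r * m) f x) x≤N
                      (λ m x<m _ → ∑<-zero N (λ r _ → beyond (x<m→ r m x<m))) ⟩
    ∑≢ k x (λ m → ∑[ r < N ] shift (suc r * m) f x)
      ≡⟨ ∑≢-cong k x (λ m 0<m _ → ∑<-truncate (λ r → shift (suc r * m) f x) x≤N
                                                (λ r x≤r _ → beyond (x≤r→ r m x≤r 0<m))) ⟩
    ∑≢ k x (λ m → ∑[ r < x ] shift (suc r * m) f x) ∎
    where
      open ≡-Reasoning
      beyond : ∀ {s} → x < s → shift s f x ≡ ε
      beyond x<s = shift-≰ f (<⇒≱ x<s)
      x<m→ : ∀ r m → x < m → x < suc r * m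
      x<m→ r m x<m = <-≤-trans x<m (m≤n*m m (suc r))
      x≤r→ : ∀ r m → x ≤ r → 0 < m → x < suc r * m
      x≤r→ r m x≤r 0<m = ≤-trans (s≤s x≤r) (m≤m*n (suc r) m {{>-nonZero 0<m}})

module SumHomomorphism
  {A B : Set} {_∙_ : A → A → A} {ε : A} {_∘'_ : B → B → B} {ε' : B}
  (isCMA : IsCommutativeMonoid _≡_ _∙_ ε) (isCMB : IsCommutativeMonoid _≡_ _∘'_ ε')
  (h : A → B) (h-ε : h ε ≡ ε') (h-∙ : ∀ x y → h (x ∙ y) ≡ h x ∘' h y) where

  open import Data.Bool using (true; false; if_then_else_)
  open import Data.Nat using (zero; suc; _*_; _≤?_; _≟_)
  open import Function using (_∘_)
  open import Relation.Nullary using (yes; no; does)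

  private
    module S = CommutativeMonoidSums isCMA
    module T = CommutativeMonoidSums isCMB

  ∑<-hom : ∀ n (f : ℕ → A) → h (S.∑< n f) ≡ T.∑< n (h ∘ f)
  ∑<-hom zero    f = h-ε
  ∑<-hom (suc n) f = trans (h-∙ _ _) (cong (h (f 0) ∘'_) (∑<-hom n (f ∘ suc)))

  shift-hom : ∀ s (f : ℕ → A) n → h (S.shift s f n) ≡ T.shift s (h ∘ f) n
  shift-hom s f n with s ≤? n
  ... | yes _ = refl
  ... | no  _ = h-ε

  ∑≢-hom : ∀ k n (f : ℕ → A) → h (S.∑≢ k n f) ≡ T.∑≢ k n (h ∘ f)
  ∑≢-hom k n f = trans (∑<-hom n _) (T.∑<-cong n (λ i _ → h-unless (does (suc i ≟ k))))
    where
      h-unless : ∀ b {x} → h (if b then ε else x) ≡ (if b then ε' else h x)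
      h-unless true  = h-ε
      h-unless false = refl

  Λ-hom : ∀ k N (f : ℕ → A) x → h (S.Λ k N f x) ≡ T.Λ k N (h ∘ f) x
  Λ-hom k N f x = trans (∑≢-hom k N (λ m → S.∑< N (λ r → S.shift (suc r * m) f x)))
    (T.∑≢-cong k N (λ m _ _ → trans (∑<-hom N (λ r → S.shift (suc r * m) f x))
                                    (T.∑<-cong N (λ r _ → shift-hom (suc r * m) f x))))

module Counting where

  open import Data.Bool using (true; false; if_then_else_)
  open import Data.List using (List; []; _∷_; _++_; map; concatMap; filter; upTo; applyUpTo; length; replicate)
  open import Data.List.Properties
    using (map-id; map-∘; map-upTo; ++-identityʳ; filter-++; filter-none; filter-≐; filter-accept; filter-reject;
           concatMap-cong; concatMap-map; map-concatMap; length-filter)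
  open import Data.List.Relation.Unary.All as All using (All; []; _∷_)
  open import Data.List.Relation.Unary.All.Properties using (applyUpTo⁺₂; ++⁺; map⁺)
  open import Data.Nat using (zero; suc; _+_; _*_; _∸_; _<_; z≤n; s≤s; _≤?_; _<?_; _≟_; >-nonZero)
  open import Data.Nat.Divisibility using (_∣?_; divides)
  open import Data.Nat.Induction using (<-rec)
  open import Data.Nat.ListAction using (sum)
  open import Data.Nat.Properties
  open import Data.Sum using (inj₁; inj₂)
  open import Function using (_∘_)
  open import Relation.Nullary using (¬_; Dec; yes; no; does; ¬?; contradiction)
  open import Relation.Nullary.Decidable using (_×-dec_)
  open import Relation.Unary using (Decidable)
  open import Algebra.Properties.CommutativeSemigroup +-commutativeSemigroup using (interchange)

  open CommutativeMonoidSums +-0-isCommutativeMonoid public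

  𝟙 : {P : Set} → Dec P → ℕ
  𝟙 d = if does d then 1 else 0

  𝟙-yes : ∀ {P : Set} (d : Dec P) → P → 𝟙 d ≡ 1
  𝟙-yes (yes _) _ = refl
  𝟙-yes (no ¬p) p = contradiction p ¬p

  𝟙-no : ∀ {P : Set} (d : Dec P) → ¬ P → 𝟙 d ≡ 0
  𝟙-no (yes p) ¬p = contradiction p ¬p
  𝟙-no (no _)  _  = refl

  𝟙-⇔ : ∀ {P Q : Set} (p : Dec P) (q : Dec Q) → (P → Q) → (Q → P) → 𝟙 p ≡ 𝟙 q
  𝟙-⇔ p (yes q) _   Q→P = 𝟙-yes p (Q→P q)
  𝟙-⇔ p (no ¬q) P→Q _   = 𝟙-no p (¬q ∘ P→Q)

  𝟙-complement : ∀ {P Q : Set} (p : Dec P) (q : Dec Q) → (P → ¬ Q) → (¬ P → Q) → 𝟙 p + 𝟙 q ≡ 1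
  𝟙-complement (yes p) q P→¬Q _   = cong suc (𝟙-no q (P→¬Q p))
  𝟙-complement (no ¬p) q _   ¬P→Q = 𝟙-yes q (¬P→Q ¬p)

  𝟙-¬ : ∀ {P : Set} (d : Dec P) → 𝟙 (¬? d) + 𝟙 d ≡ 1
  𝟙-¬ (yes _) = refl
  𝟙-¬ (no _)  = refl

  length-filter-∑𝟙 : ∀ {X : Set} {P : X → Set} (P? : Decidable P) xs →
                     length (filter P? xs) ≡ ∑[ x ∈ xs ] 𝟙 (P? x)
  length-filter-∑𝟙 P? []       = refl
  length-filter-∑𝟙 P? (x ∷ xs) with does (P? x)
  ... | true  = cong suc (length-filter-∑𝟙 P? xs)
  ... | false = length-filter-∑𝟙 P? xs

  ∑∈-1 : ∀ {X : Set} (xs : List X) → ∑[ x ∈ xs ] 1 ≡ length xs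
  ∑∈-1 []       = refl
  ∑∈-1 (x ∷ xs) = cong suc (∑∈-1 xs)

  ∑<-1 : ∀ n → ∑[ i < n ] 1 ≡ n
  ∑<-1 zero    = refl
  ∑<-1 (suc n) = cong suc (∑<-1 n)

  ∑<-𝟙-< : ∀ {a n} → a ≤ n → ∑[ i < n ] 𝟙 (i <? a) ≡ a
  ∑<-𝟙-< {a} {n} a≤n = begin
    ∑[ i < n ] 𝟙 (i <? a)  ≡⟨ ∑<-truncate _ a≤n (λ i a≤i _ → 𝟙-no (i <? a) (≤⇒≯ a≤i)) ⟩
    ∑[ i < a ] 𝟙 (i <? a)  ≡⟨ ∑<-cong a (λ i i<a → 𝟙-yes (i <? a) i<a) ⟩
    ∑[ i < a ] 1           ≡⟨ ∑<-1 a ⟩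
    a                      ∎
    where open ≡-Reasoning

  ∑<-𝟙-≥ : ∀ {a n} → a ≤ n → a + ∑[ i < n ] 𝟙 (a ≤? i) ≡ n
  ∑<-𝟙-≥ {a} {n} a≤n = begin
    a + ∑[ i < n ] 𝟙 (a ≤? i)
      ≡⟨ cong (_+ ∑[ i < n ] 𝟙 (a ≤? i)) (∑<-𝟙-< a≤n) ⟨
    ∑[ i < n ] 𝟙 (i <? a) + ∑[ i < n ] 𝟙 (a ≤? i)
      ≡⟨ ∑<-distrib n _ _ ⟨
    ∑[ i < n ] (𝟙 (i <? a) + 𝟙 (a ≤? i))
      ≡⟨ ∑<-cong n (λ i _ → 𝟙-complement (i <? a) (a ≤? i) <⇒≱ ≮⇒≥) ⟩
    ∑[ i < n ] 1
      ≡⟨ ∑<-1 n ⟩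
    n ∎
    where open ≡-Reasoning

  ∑∈-+-∑<-𝟙≤ : ∀ {X : Set} n (f : X → ℕ) xs → All (λ x → f x ≤ n) xs →
               ∑∈ xs f + ∑[ i < n ] ∑[ x ∈ xs ] 𝟙 (f x ≤? i) ≡ length xs * n
  ∑∈-+-∑<-𝟙≤ n f xs f≤n = begin
    ∑∈ xs f + ∑[ i < n ] ∑[ x ∈ xs ] 𝟙 (f x ≤? i)
      ≡⟨ cong (∑∈ xs f +_) (∑∈-∑<-comm (λ x i → 𝟙 (f x ≤? i)) n xs) ⟨
    ∑∈ xs f + ∑[ x ∈ xs ] ∑[ i < n ] 𝟙 (f x ≤? i)
      ≡⟨ ∑∈-distrib f _ xs ⟨
    ∑[ x ∈ xs ] (f x + ∑[ i < n ] 𝟙 (f x ≤? i))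
      ≡⟨ ∑∈-cong-local f≤n (λ x → ∑<-𝟙-≥) ⟩
    ∑[ x ∈ xs ] n
      ≡⟨ ∑∈-const xs ⟩
    length xs * n ∎
    where
      open ≡-Reasoning
      ∑∈-const : ∀ {X : Set} (xs : List X) → ∑[ x ∈ xs ] n ≡ length xs * n
      ∑∈-const []       = refl
      ∑∈-const (x ∷ xs) = cong (n +_) (∑∈-const xs)

  ∑∈-equidistributed : ∀ {X : Set} n (f g : X → ℕ) xs → All (λ x → f x ≤ n) xs → All (λ x → g x ≤ n) xs →
                       (∀ i → i < n → ∑[ x ∈ xs ] 𝟙 (f x ≤? i) ≡ ∑[ x ∈ xs ] 𝟙 (g x ≤? i)) →
                       ∑∈ xs f ≡ ∑∈ xs g
  ∑∈-equidistributed n f g xs f≤n g≤n same = +-cancelʳ-≡ _ (∑∈ xs f) (∑∈ xs g) (begin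
    ∑∈ xs f + ∑[ i < n ] ∑[ x ∈ xs ] 𝟙 (f x ≤? i)  ≡⟨ ∑∈-+-∑<-𝟙≤ n f xs f≤n ⟩
    length xs * n                                 ≡⟨ ∑∈-+-∑<-𝟙≤ n g xs g≤n ⟨
    ∑∈ xs g + ∑[ i < n ] ∑[ x ∈ xs ] 𝟙 (g x ≤? i)  ≡⟨ cong (∑∈ xs g +_) (∑<-cong n same) ⟨
    ∑∈ xs g + ∑[ i < n ] ∑[ x ∈ xs ] 𝟙 (f x ≤? i)  ∎)
    where open ≡-Reasoning

  filter-map : ∀ {X Y : Set} {P : Y → Set} (P? : Decidable P) (f : X → Y) xs →
               filter P? (map f xs) ≡ map f (filter (P? ∘ f) xs)
  filter-map P? f []       = refl
  filter-map P? f (x ∷ xs) with does (P? (f x))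
  ... | true  = cong (f x ∷_) (filter-map P? f xs)
  ... | false = filter-map P? f xs

  applyUpTo-+ : ∀ {X : Set} (f : ℕ → X) m n → applyUpTo f (m + n) ≡ applyUpTo f m ++ applyUpTo (f ∘ (m +_)) n
  applyUpTo-+ f zero    n = refl
  applyUpTo-+ f (suc m) n = cong (f 0 ∷_) (applyUpTo-+ (f ∘ suc) m n)

  filter-upTo-truncate : ∀ {P : ℕ → Set} (P? : Decidable P) {m n} → m ≤ n → (∀ i → m ≤ i → ¬ P i) →
                         filter P? (upTo n) ≡ filter P? (upTo m)
  filter-upTo-truncate P? {m} {n} m≤n ¬P = begin
    filter P? (upTo n)
      ≡⟨ cong (filter P? ∘ upTo) (m+[n∸m]≡n m≤n) ⟨
    filter P? (upTo (m + (n ∸ m)))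
      ≡⟨ cong (filter P?) (applyUpTo-+ (λ i → i) m (n ∸ m)) ⟩
    filter P? (upTo m ++ applyUpTo (m +_) (n ∸ m))
      ≡⟨ filter-++ P? (upTo m) _ ⟩
    filter P? (upTo m) ++ filter P? (applyUpTo (m +_) (n ∸ m))
      ≡⟨ cong (filter P? (upTo m) ++_)
              (filter-none P? (applyUpTo⁺₂ _ (n ∸ m) (λ i → ¬P (m + i) (m≤m+n m i)))) ⟩
    filter P? (upTo m) ++ []
      ≡⟨ ++-identityʳ _ ⟩
    filter P? (upTo m) ∎
    where open ≡-Reasoning

  module _ (m n : ℕ) where

    private
      d = suc m

      withCopies : ℕ → List (List ℕ)
      withCopies c = map (replicate c d ++_) (partitionsBounded m (n ∸ c * d))

      unfold : partitionsBounded (suc m) n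
               ≡ partitionsBounded m n ++ concatMap withCopies (filter (λ c → c * d ≤? n) (applyUpTo suc n))
      unfold = cong (_++ concatMap withCopies (filter (λ c → c * d ≤? n) (applyUpTo suc n)))
                    (map-id (partitionsBounded m n))

    partitionsBounded-small : n < suc m → partitionsBounded (suc m) n ≡ partitionsBounded m n
    partitionsBounded-small n<d = begin
      partitionsBounded (suc m) n
        ≡⟨ unfold ⟩
      partitionsBounded m n ++ concatMap withCopies (filter (λ c → c * d ≤? n) (applyUpTo suc n))
        ≡⟨ cong (λ cs → partitionsBounded m n ++ concatMap withCopies cs)
                (filter-none (λ c → c * d ≤? n) (applyUpTo⁺₂ suc n (λ i → <⇒≱ (<-≤-trans n<d (m≤m+n d (i * d)))))) ⟩
      partitionsBounded m n ++ []
        ≡⟨ ++-identityʳ _ ⟩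
      partitionsBounded m n ∎
      where open ≡-Reasoning

    partitionsBounded-large : suc m ≤ n →
      partitionsBounded (suc m) n ≡ partitionsBounded m n ++ map (suc m ∷_) (partitionsBounded (suc m) (n ∸ suc m))
    partitionsBounded-large d≤n = trans unfold (cong (partitionsBounded m n ++_) (begin
      concatMap withCopies (filter (λ c → c * d ≤? n) (applyUpTo suc n))
        ≡⟨ cong (concatMap withCopies ∘ filter (λ c → c * d ≤? n)) (map-upTo suc n) ⟨
      concatMap withCopies (filter (λ c → c * d ≤? n) (map suc (upTo n)))
        ≡⟨ cong (concatMap withCopies) (filter-map (λ c → c * d ≤? n) suc (upTo n)) ⟩
      concatMap withCopies (map suc (filter (λ c → suc c * d ≤? n) (upTo n)))
        ≡⟨ concatMap-map withCopies suc (filter (λ c → suc c * d ≤? n) (upTo n)) ⟩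
      concatMap (withCopies ∘ suc) (filter (λ c → suc c * d ≤? n) (upTo n))
        ≡⟨ cong (concatMap (withCopies ∘ suc))
                (filter-≐ (λ c → suc c * d ≤? n) Q? ((λ {c} → ≤n⇒≤n∸d {c}) , (λ {c} → ≤n∸d⇒≤n {c})) (upTo n)) ⟩
      concatMap (withCopies ∘ suc) (filter Q? (upTo n))
        ≡⟨ cong (concatMap (withCopies ∘ suc))
                (filter-upTo-truncate Q? n∸d<n (λ i n∸d<i → <⇒≱ (<-≤-trans n∸d<i (m≤m*n i d)))) ⟩
      concatMap (withCopies ∘ suc) (filter Q? (upTo (suc (n ∸ d))))
        ≡⟨ concatMap-cong withCopies-suc (filter Q? (upTo (suc (n ∸ d)))) ⟩
      concatMap (map (d ∷_) ∘ withCopies′) (filter Q? (upTo (suc (n ∸ d))))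
        ≡⟨ map-concatMap (d ∷_) withCopies′ (filter Q? (upTo (suc (n ∸ d)))) ⟨
      map (d ∷_) (partitionsBounded (suc m) (n ∸ d))  ∎))
      where
        open ≡-Reasoning
        Q? = λ c → c * d ≤? n ∸ d
        withCopies′ : ℕ → List (List ℕ)
        withCopies′ c = map (replicate c d ++_) (partitionsBounded m (n ∸ d ∸ c * d))
        withCopies-suc : ∀ c → withCopies (suc c) ≡ map (d ∷_) (withCopies′ c)
        withCopies-suc c = trans (cong (map (replicate (suc c) d ++_) ∘ partitionsBounded m)
                                       (sym (∸-+-assoc n d (c * d))))
                                 (map-∘ (partitionsBounded m (n ∸ d ∸ c * d)))
        ≤n⇒≤n∸d : ∀ {c} → suc c * d ≤ n → c * d ≤ n ∸ d
        ≤n⇒≤n∸d {c} le = subst (_≤ n ∸ d) (m+n∸m≡n d (c * d)) (∸-monoˡ-≤ d le)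
        ≤n∸d⇒≤n : ∀ {c} → c * d ≤ n ∸ d → suc c * d ≤ n
        ≤n∸d⇒≤n {c} le = subst (d + c * d ≤_) (m+[n∸m]≡n d≤n) (+-monoʳ-≤ d le)
        n∸d<n : n ∸ d < n
        n∸d<n = ∸-monoʳ-< (s≤s z≤n) d≤n

  ∑∈-partitionsBounded-suc : ∀ m n (g : List ℕ → ℕ) →
    ∑[ π ∈ partitionsBounded (suc m) n ] g π
      ≡ ∑[ π ∈ partitionsBounded m n ] g π + shift (suc m) (λ x → ∑[ π ∈ partitionsBounded (suc m) x ] g (suc m ∷ π)) n
  ∑∈-partitionsBounded-suc m n g with suc m ≤? n
  ... | yes d≤n = begin
    ∑∈ (partitionsBounded (suc m) n) g
      ≡⟨ cong (λ πs → ∑∈ πs g) (partitionsBounded-large m n d≤n) ⟩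
    ∑∈ (partitionsBounded m n ++ map (suc m ∷_) (partitionsBounded (suc m) (n ∸ suc m))) g
      ≡⟨ ∑∈-++ g (partitionsBounded m n) _ ⟩
    ∑∈ (partitionsBounded m n) g + ∑∈ (map (suc m ∷_) (partitionsBounded (suc m) (n ∸ suc m))) g
      ≡⟨ cong (∑∈ (partitionsBounded m n) g +_) (∑∈-map g (suc m ∷_) (partitionsBounded (suc m) (n ∸ suc m))) ⟩
    ∑∈ (partitionsBounded m n) g + ∑[ π ∈ partitionsBounded (suc m) (n ∸ suc m) ] g (suc m ∷ π) ∎
    where open ≡-Reasoning
  ... | no d≰n = trans (cong (λ πs → ∑∈ πs g) (partitionsBounded-small m n (≰⇒> d≰n))) (sym (+-identityʳ _))

  PartsIn : ℕ → List ℕ → Set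
  PartsIn M = All (λ x → 1 ≤ x × x ≤ M)

  IsPartition : ℕ → ℕ → List ℕ → Set
  IsPartition M n π = PartsIn M π × sum π ≡ n

  partitionsBounded-sound : ∀ M n → All (IsPartition M n) (partitionsBounded M n)
  partitionsBounded-sound zero    zero    = ([] , refl) ∷ []
  partitionsBounded-sound zero    (suc n) = []
  partitionsBounded-sound (suc m) = <-rec _ step
    where
      widen : ∀ {n} → All (IsPartition m n) (partitionsBounded m n) → All (IsPartition (suc m) n) (partitionsBounded m n)
      widen = All.map (λ (parts , total) → All.map (λ (1≤x , x≤m) → 1≤x , m≤n⇒m≤1+n x≤m) parts , total)
      step : ∀ n → (∀ {x} → x < n → All (IsPartition (suc m) x) (partitionsBounded (suc m) x)) →
             All (IsPartition (suc m) n) (partitionsBounded (suc m) n)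
      step n ih with suc m ≤? n
      ... | no d≰n  = subst (All (IsPartition (suc m) n)) (sym (partitionsBounded-small m n (≰⇒> d≰n)))
                            (widen (partitionsBounded-sound m n))
      ... | yes d≤n = subst (All (IsPartition (suc m) n)) (sym (partitionsBounded-large m n d≤n))
                            (++⁺ (widen (partitionsBounded-sound m n))
                                 (map⁺ (All.map (λ (parts , total) → ((s≤s z≤n , ≤-refl) ∷ parts) ,
                                                                      trans (cong (suc m +_) total) (m+[n∸m]≡n d≤n))
                                                (ih (∸-monoʳ-< (s≤s z≤n) d≤n)))))

  partitions-sound : ∀ n → All (IsPartition n n) (partitions n)
  partitions-sound n = partitionsBounded-sound n n

  p : ℕ → ℕ → ℕ
  p M n = length (partitionsBounded M n)

  p∞ : ℕ → ℕ
  p∞ n = p n n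

  p-suc : ∀ m n → p (suc m) n ≡ p m n + shift (suc m) (p (suc m)) n
  p-suc m n = begin
    p (suc m) n
      ≡⟨ ∑∈-1 (partitionsBounded (suc m) n) ⟨
    ∑[ π ∈ partitionsBounded (suc m) n ] 1
      ≡⟨ ∑∈-partitionsBounded-suc m n (λ _ → 1) ⟩
    ∑[ π ∈ partitionsBounded m n ] 1 + shift (suc m) (λ x → ∑[ π ∈ partitionsBounded (suc m) x ] 1) n
      ≡⟨ cong₂ _+_ (∑∈-1 (partitionsBounded m n))
                   (shift-cong (suc m) n (λ _ → ∑∈-1 (partitionsBounded (suc m) (n ∸ suc m)))) ⟩
    p m n + shift (suc m) (p (suc m)) n ∎
    where open ≡-Reasoning

  p-stable : ∀ {M n} → n ≤ M → p M n ≡ p∞ n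
  p-stable {zero}  z≤n = refl
  p-stable {suc M} {n} n≤M with n ≟ suc M
  ... | yes refl = refl
  ... | no  n≢M  = trans (cong length (partitionsBounded-small M n (s≤s n≤M′))) (p-stable n≤M′)
    where n≤M′ = ≤-pred (≤∧≢⇒< n≤M n≢M)

  shift-recurrence-unique : ∀ d → 0 < d → (a F G : ℕ → ℕ) →
    (∀ n → F n ≡ a n + shift d F n) → (∀ n → G n ≡ a n + shift d G n) → ∀ n → F n ≡ G n
  shift-recurrence-unique d 0<d a F G F-rec G-rec = <-rec _ step
    where
      step : ∀ n → (∀ {x} → x < n → F x ≡ G x) → F n ≡ G n
      step n ih = begin
        F n                ≡⟨ F-rec n ⟩
        a n + shift d F n  ≡⟨ cong (a n +_) (shift-cong d n (λ d≤n → ih (∸-monoʳ-< 0<d d≤n))) ⟩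
        a n + shift d G n  ≡⟨ G-rec n ⟨
        G n                ∎
        where open ≡-Reasoning

  countPartitions : ℕ → ℕ → {P : List ℕ → Set} → Decidable P → ℕ
  countPartitions M n P? = ∑[ π ∈ partitionsBounded M n ] 𝟙 (P? π)

  largestPart-≤ : ∀ {M} π → PartsIn M π → largestPart π ≤ M
  largestPart-≤ []      []                  = z≤n
  largestPart-≤ (x ∷ π) ((_ , x≤M) ∷ parts) = ⊔-lub x≤M (largestPart-≤ π parts)

  count-largestPart≤ : ∀ {i M} n → i ≤ M → countPartitions M n (λ π → largestPart π ≤? i) ≡ p i n
  count-largestPart≤ {i} {M} n i≤M with m≤n⇒m<n∨m≡n i≤M
  ... | inj₂ refl = begin
    ∑[ π ∈ partitionsBounded i n ] 𝟙 (largestPart π ≤? i)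
      ≡⟨ ∑∈-cong-local (partitionsBounded-sound i n)
          (λ π (parts , _) → 𝟙-yes (largestPart π ≤? i) (largestPart-≤ π parts)) ⟩
    ∑[ π ∈ partitionsBounded i n ] 1
      ≡⟨ ∑∈-1 (partitionsBounded i n) ⟩
    p i n ∎
    where open ≡-Reasoning
  count-largestPart≤ {i} {suc m} n _ | inj₁ (s≤s i≤m) = begin
    countPartitions (suc m) n (λ π → largestPart π ≤? i)
      ≡⟨ ∑∈-partitionsBounded-suc m n (λ π → 𝟙 (largestPart π ≤? i)) ⟩
    countPartitions m n (λ π → largestPart π ≤? i) + shift (suc m) withPart n
      ≡⟨ cong (countPartitions m n (λ π → largestPart π ≤? i) +_)
              (shift-ε (suc m) n (λ x → ∑∈-zero (partitionsBounded (suc m) x) too-large)) ⟩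
    countPartitions m n (λ π → largestPart π ≤? i) + 0
      ≡⟨ +-identityʳ _ ⟩
    countPartitions m n (λ π → largestPart π ≤? i)
      ≡⟨ count-largestPart≤ n i≤m ⟩
    p i n ∎
    where
      open ≡-Reasoning
      withPart : ℕ → ℕ
      withPart x = ∑[ ρ ∈ partitionsBounded (suc m) x ] 𝟙 (largestPart (suc m ∷ ρ) ≤? i)
      too-large : ∀ ρ → 𝟙 (largestPart (suc m ∷ ρ) ≤? i) ≡ 0
      too-large ρ = 𝟙-no (largestPart (suc m ∷ ρ) ≤? i)
                         (λ ℓ≤i → ≤⇒≯ (≤-trans (m≤m⊔n (suc m) (largestPart ρ)) ℓ≤i) (s≤s i≤m))

  δ : ℕ → ℕ
  δ zero    = 1
  δ (suc _) = 0

  -- pBox M j n is the number of partitions of n into at most j parts, each ≤ M.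
  pBox : ℕ → ℕ → ℕ → ℕ
  pBox zero    j       n = δ n
  pBox (suc m) zero    n = δ n
  pBox (suc m) (suc j) n = pBox m (suc j) n + shift (suc m) (pBox (suc m) j) n

  pBox-zeroʳ : ∀ M n → pBox M 0 n ≡ δ n
  pBox-zeroʳ zero    n = refl
  pBox-zeroʳ (suc M) n = refl

  count-length≤ : ∀ M j n → countPartitions M n (λ π → length π ≤? j) ≡ pBox M j n
  count-length≤ zero    j zero    = refl
  count-length≤ zero    j (suc n) = refl
  count-length≤ (suc m) zero n = begin
    countPartitions (suc m) n (λ π → length π ≤? 0)
      ≡⟨ ∑∈-partitionsBounded-suc m n (λ π → 𝟙 (length π ≤? 0)) ⟩
    countPartitions m n (λ π → length π ≤? 0) + shift (suc m) (λ x → ∑[ ρ ∈ partitionsBounded (suc m) x ] 0) n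
      ≡⟨ cong₂ _+_ (count-length≤ m 0 n)
                   (shift-ε (suc m) n (λ x → ∑∈-zero (partitionsBounded (suc m) x) (λ _ → refl))) ⟩
    pBox m 0 n + 0
      ≡⟨ +-identityʳ _ ⟩
    pBox m 0 n
      ≡⟨ pBox-zeroʳ m n ⟩
    δ n ∎
    where open ≡-Reasoning
  count-length≤ (suc m) (suc j) n =
    trans (∑∈-partitionsBounded-suc m n (λ π → 𝟙 (length π ≤? suc j)))
          (cong₂ _+_ (count-length≤ m (suc j) n) (shift-cong (suc m) n (λ _ → trans
            (∑∈-cong (partitionsBounded (suc m) (n ∸ suc m))
                     (λ ρ → 𝟙-⇔ (suc (length ρ) ≤? suc j) (length ρ ≤? j) ≤-pred s≤s))
            (count-length≤ (suc m) j (n ∸ suc m)))))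

  pBox-suc-suc′ : ∀ m j n → pBox (suc m) (suc j) n ≡ pBox (suc m) j n + shift (suc j) (pBox m (suc j)) n
  pBox-suc-suc′ zero    zero    n = refl
  pBox-suc-suc′ zero    (suc j) n = begin
    δ n + shift 1 (pBox 1 (suc j)) n
      ≡⟨ cong (δ n +_) (trans (shift-cong 1 n (λ _ → pBox-suc-suc′ 0 j _)) (shift-distrib 1 (pBox 1 j) _ n)) ⟩
    δ n + (shift 1 (pBox 1 j) n + shift 1 (shift (suc j) δ) n)
      ≡⟨ +-assoc (δ n) _ _ ⟨
    δ n + shift 1 (pBox 1 j) n + shift 1 (shift (suc j) δ) n
      ≡⟨ cong (δ n + shift 1 (pBox 1 j) n +_) (shift-shift 1 (suc j) δ n) ⟩
    δ n + shift 1 (pBox 1 j) n + shift (suc (suc j)) δ n ∎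
    where open ≡-Reasoning
  pBox-suc-suc′ (suc m) zero    n = begin
    pBox (suc m) 1 n + shift (suc (suc m)) δ n
      ≡⟨ cong (_+ shift (suc (suc m)) δ n) (pBox-suc-suc′ m 0 n) ⟩
    δ n + shift 1 (pBox m 1) n + shift (suc (suc m)) δ n
      ≡⟨ +-assoc (δ n) _ _ ⟩
    δ n + (shift 1 (pBox m 1) n + shift (suc (suc m)) δ n)
      ≡⟨ cong (λ t → δ n + (shift 1 (pBox m 1) n + t)) (shift-shift 1 (suc m) δ n) ⟨
    δ n + (shift 1 (pBox m 1) n + shift 1 (shift (suc m) δ) n)
      ≡⟨ cong (δ n +_) (shift-distrib 1 (pBox m 1) (shift (suc m) δ) n) ⟨
    δ n + shift 1 (pBox (suc m) 1) n  ∎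
    where open ≡-Reasoning
  pBox-suc-suc′ (suc m) (suc j) n = begin
    pBox (suc m) (suc (suc j)) n + shift (suc (suc m)) (pBox (suc (suc m)) (suc j)) n
      ≡⟨ cong₂ _+_ (pBox-suc-suc′ m (suc j) n)
                   (trans (shift-cong (suc (suc m)) n (λ _ → pBox-suc-suc′ (suc m) j _)) (shift-distrib (suc (suc m)) _ _ n)) ⟩
    (pBox (suc m) (suc j) n + shift (suc (suc j)) (pBox m (suc (suc j))) n)
      + (shift (suc (suc m)) (pBox (suc (suc m)) j) n + shift (suc (suc m)) (shift (suc j) (pBox (suc m) (suc j))) n)
      ≡⟨ interchange (pBox (suc m) (suc j) n) (shift (suc (suc j)) (pBox m (suc (suc j))) n)
                     (shift (suc (suc m)) (pBox (suc (suc m)) j) n)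
                     (shift (suc (suc m)) (shift (suc j) (pBox (suc m) (suc j))) n) ⟩
    (pBox (suc m) (suc j) n + shift (suc (suc m)) (pBox (suc (suc m)) j) n)
      + (shift (suc (suc j)) (pBox m (suc (suc j))) n + shift (suc (suc m)) (shift (suc j) (pBox (suc m) (suc j))) n)
      ≡⟨ cong (λ t → pBox (suc (suc m)) (suc j) n + (shift (suc (suc j)) (pBox m (suc (suc j))) n + t)) shifts-swap ⟩
    pBox (suc (suc m)) (suc j) n
      + (shift (suc (suc j)) (pBox m (suc (suc j))) n + shift (suc (suc j)) (shift (suc m) (pBox (suc m) (suc j))) n)
      ≡⟨ cong (pBox (suc (suc m)) (suc j) n +_) (shift-distrib (suc (suc j)) _ _ n) ⟨
    pBox (suc (suc m)) (suc j) n + shift (suc (suc j)) (pBox (suc m) (suc (suc j))) n ∎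
    where
      open ≡-Reasoning
      shifts-swap : shift (suc (suc m)) (shift (suc j) (pBox (suc m) (suc j))) n
                  ≡ shift (suc (suc j)) (shift (suc m) (pBox (suc m) (suc j))) n
      shifts-swap = begin
        shift (suc (suc m)) (shift (suc j) (pBox (suc m) (suc j))) n
          ≡⟨ shift-shift (suc (suc m)) (suc j) _ n ⟩
        shift (suc (suc m + suc j)) (pBox (suc m) (suc j)) n
          ≡⟨ cong (λ s → shift (suc s) (pBox (suc m) (suc j)) n)
              (+-comm (suc m) (suc j)) ⟩
        shift (suc (suc j + suc m)) (pBox (suc m) (suc j)) n
          ≡⟨ shift-shift (suc (suc j)) (suc m) _ n ⟨
        shift (suc (suc j)) (shift (suc m) (pBox (suc m) (suc j))) n ∎

  pBox-sym : ∀ M j n → pBox M j n ≡ pBox j M n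
  pBox-sym zero    zero    n = refl
  pBox-sym zero    (suc j) n = refl
  pBox-sym (suc m) zero    n = refl
  pBox-sym (suc m) (suc j) n =
    trans (cong₂ _+_ (pBox-sym m (suc j) n) (shift-cong (suc m) n (λ _ → pBox-sym (suc m) j _)))
          (sym (pBox-suc-suc′ j m n))

  length-≤-sum : ∀ {M} π → PartsIn M π → length π ≤ sum π
  length-≤-sum []      []                  = z≤n
  length-≤-sum (x ∷ π) ((1≤x , _) ∷ parts) = +-mono-≤ 1≤x (length-≤-sum π parts)

  pBox-tall : ∀ M {N n} → n ≤ N → pBox M N n ≡ p M n
  pBox-tall M {N} {n} n≤N = begin
    pBox M N n
      ≡⟨ count-length≤ M N n ⟨
    ∑[ π ∈ partitionsBounded M n ] 𝟙 (length π ≤? N)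
      ≡⟨ ∑∈-cong-local (partitionsBounded-sound M n) (λ π (parts , total) →
          𝟙-yes (length π ≤? N) (≤-trans (length-≤-sum π parts) (subst (_≤ N) (sym total) n≤N))) ⟩
    ∑[ π ∈ partitionsBounded M n ] 1
      ≡⟨ ∑∈-1 (partitionsBounded M n) ⟩
    p M n ∎
    where open ≡-Reasoning

  mult-cons-≡ : ∀ i ρ → mult i (i ∷ ρ) ≡ suc (mult i ρ)
  mult-cons-≡ i ρ = cong length (filter-accept (_≟ i) refl)

  mult-cons-≢ : ∀ {x i} ρ → x ≢ i → mult i (x ∷ ρ) ≡ mult i ρ
  mult-cons-≢ {i = i} ρ x≢i = cong length (filter-reject (_≟ i) x≢i)

  mult-beyond : ∀ {M i} π → PartsIn M π → M < i → mult i π ≡ 0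
  mult-beyond {i = i} π parts M<i =
    cong length (filter-none (_≟ i) (All.map (λ { (_ , x≤M) refl → ≤⇒≯ x≤M M<i }) parts))

  count-mult≥-zero : ∀ {c i M} n → 0 < c → M < i → countPartitions M n (λ π → c ≤? mult i π) ≡ 0
  count-mult≥-zero {c} {i} {M} n 0<c M<i = trans
    (∑∈-cong-local (partitionsBounded-sound M n) (λ π (parts , _) →
       𝟙-no (c ≤? mult i π) (λ c≤mult → ≤⇒≯ (subst (c ≤_) (mult-beyond π parts M<i) c≤mult) 0<c)))
    (∑∈-zero (partitionsBounded M n) (λ _ → refl))

  count-mult≥-top : ∀ c m n → countPartitions (suc m) n (λ π → c ≤? mult (suc m) π) ≡ shift (c * suc m) (p (suc m)) n
  count-mult≥-top zero    m n = trans (∑∈-1 (partitionsBounded (suc m) n)) (sym (shift-zero (p (suc m)) n))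
  count-mult≥-top (suc c) m n = begin
    countPartitions (suc m) n (λ π → suc c ≤? mult (suc m) π)
      ≡⟨ ∑∈-partitionsBounded-suc m n (λ π → 𝟙 (suc c ≤? mult (suc m) π)) ⟩
    countPartitions m n (λ π → suc c ≤? mult (suc m) π)
      + shift (suc m) (λ x → ∑[ ρ ∈ partitionsBounded (suc m) x ] 𝟙 (suc c ≤? mult (suc m) (suc m ∷ ρ))) n
      ≡⟨ cong₂ _+_ (count-mult≥-zero {suc c} {suc m} {m} n (s≤s z≤n) ≤-refl) (shift-cong (suc m) n (λ _ → trans
           (∑∈-cong (partitionsBounded (suc m) (n ∸ suc m)) (λ ρ →
              𝟙-⇔ (suc c ≤? mult (suc m) (suc m ∷ ρ)) (c ≤? mult (suc m) ρ)
                  (λ le → ≤-pred (subst (suc c ≤_) (mult-cons-≡ (suc m) ρ) le))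
                  (λ le → subst (suc c ≤_) (sym (mult-cons-≡ (suc m) ρ)) (s≤s le))))
           (count-mult≥-top c m (n ∸ suc m)))) ⟩
    0 + shift (suc m) (shift (c * suc m) (p (suc m))) n
      ≡⟨ shift-shift (suc m) (c * suc m) (p (suc m)) n ⟩
    shift (suc c * suc m) (p (suc m)) n ∎
    where open ≡-Reasoning

  count-mult≥ : ∀ c {i M} n → 0 < i → i ≤ M → countPartitions M n (λ π → c ≤? mult i π) ≡ shift (c * i) (p M) n
  count-mult≥ c {i} {M} n 0<i i≤M with m≤n⇒m<n∨m≡n i≤M
  count-mult≥ c {suc m} n 0<i i≤M | inj₂ refl = count-mult≥-top c m n
  count-mult≥ c {i} {suc m} n 0<i i≤M | inj₁ (s≤s i≤m) =
    shift-recurrence-unique (suc m) (s≤s z≤n) (λ x → shift (c * i) (p m) x) F G F-rec G-rec n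
    where
      F G : ℕ → ℕ
      F x = countPartitions (suc m) x (λ π → c ≤? mult i π)
      G x = shift (c * i) (p (suc m)) x
      F-rec : ∀ x → F x ≡ shift (c * i) (p m) x + shift (suc m) F x
      F-rec x = trans (∑∈-partitionsBounded-suc m x (λ π → 𝟙 (c ≤? mult i π)))
        (cong₂ _+_ (count-mult≥ c x 0<i i≤m)
                   (shift-cong (suc m) x (λ _ → ∑∈-cong (partitionsBounded (suc m) (x ∸ suc m))
                     (λ ρ → cong (λ k → 𝟙 (c ≤? k)) (mult-cons-≢ ρ (λ m≡i → ≤⇒≯ i≤m (≤-reflexive m≡i)))))))
      G-rec : ∀ x → G x ≡ shift (c * i) (p m) x + shift (suc m) G x
      G-rec x = begin
        shift (c * i) (p (suc m)) x
          ≡⟨ shift-cong (c * i) x (λ _ → p-suc m _) ⟩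
        shift (c * i) (λ y → p m y + shift (suc m) (p (suc m)) y) x
          ≡⟨ shift-distrib (c * i) (p m) _ x ⟩
        shift (c * i) (p m) x + shift (c * i) (shift (suc m) (p (suc m))) x
          ≡⟨ cong (shift (c * i) (p m) x +_) (shift-comm (c * i) (suc m) (p (suc m)) x) ⟩
        shift (c * i) (p m) x + shift (suc m) G x ∎
        where open ≡-Reasoning

  count-mult≥-partitions : ∀ c {i} n → 0 < i → countPartitions n n (λ π → c ≤? mult i π) ≡ shift (c * i) (p n) n
  count-mult≥-partitions c {i} n 0<i with i ≤? n
  ... | yes i≤n = count-mult≥ c n 0<i i≤n
  count-mult≥-partitions zero    {i} n 0<i | no _ = trans (∑∈-1 (partitions n)) (sym (shift-zero (p n) n))
  count-mult≥-partitions (suc c) {i} n 0<i | no i≰n =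
    trans (count-mult≥-zero n (s≤s z≤n) (≰⇒> i≰n))
          (sym (shift-≰ (p n) (λ ci≤n → i≰n (≤-trans (m≤n*m i (suc c)) ci≤n))))

  parts-≤-largestPart : ∀ {M} π → PartsIn M π → PartsIn (largestPart π) π
  parts-≤-largestPart []      []                  = []
  parts-≤-largestPart (x ∷ π) ((1≤x , _) ∷ parts) =
    (1≤x , m≤m⊔n x (largestPart π))
      ∷ All.map (λ (1≤y , y≤ℓ) → 1≤y , ≤-trans y≤ℓ (m≤n⊔m x (largestPart π))) (parts-≤-largestPart π parts)

  module _ {k} (0<k : 0 < k) where

    νd<-+-#mult≥ : ∀ {n} π → PartsIn n π → νd< k π + ∑[ i < n ] 𝟙 (k ≤? mult (suc i) π) ≡ largestPart π
    νd<-+-#mult≥ {n} π parts = begin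
      νd< k π + ∑[ i < n ] 𝟙 (k ≤? mult (suc i) π)
        ≡⟨ cong₂ _+_ νd<-as-∑ (∑<-truncate _ ℓ≤n rare-beyond-ℓ) ⟩
      ∑[ i < ℓ ] 𝟙 (mult (suc i) π <? k) + ∑[ i < ℓ ] 𝟙 (k ≤? mult (suc i) π)
        ≡⟨ ∑<-distrib ℓ _ _ ⟨
      ∑[ i < ℓ ] (𝟙 (mult (suc i) π <? k) + 𝟙 (k ≤? mult (suc i) π))
        ≡⟨ ∑<-cong ℓ (λ i _ → 𝟙-complement (mult (suc i) π <? k) (k ≤? mult (suc i) π) <⇒≱ ≮⇒≥) ⟩
      ∑[ i < ℓ ] 1
        ≡⟨ ∑<-1 ℓ ⟩
      ℓ ∎
      where
        open ≡-Reasoning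
        ℓ = largestPart π
        ℓ≤n = largestPart-≤ π parts
        νd<-as-∑ : νd< k π ≡ ∑[ i < ℓ ] 𝟙 (mult (suc i) π <? k)
        νd<-as-∑ = begin
          νd< k π
            ≡⟨ length-filter-∑𝟙 (λ i → mult i π <? k) (map suc (upTo ℓ)) ⟩
          ∑[ i ∈ map suc (upTo ℓ) ] 𝟙 (mult i π <? k)
            ≡⟨ ∑∈-map (λ i → 𝟙 (mult i π <? k)) suc (upTo ℓ) ⟩
          ∑[ i ∈ upTo ℓ ] 𝟙 (mult (suc i) π <? k)
            ≡⟨ ∑∈-applyUpTo (λ i → 𝟙 (mult (suc i) π <? k)) (λ i → i) ℓ ⟩
          ∑[ i < ℓ ] 𝟙 (mult (suc i) π <? k) ∎
        rare-beyond-ℓ : ∀ i → ℓ ≤ i → i < n → 𝟙 (k ≤? mult (suc i) π) ≡ 0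
        rare-beyond-ℓ i ℓ≤i _ = 𝟙-no (k ≤? mult (suc i) π)
          (λ k≤mult → ≤⇒≯ (subst (k ≤_) (mult-beyond π (parts-≤-largestPart π parts) (s≤s ℓ≤i)) k≤mult) 0<k)

  length-filter-≢-+-mult : ∀ k π → length (filter (λ x → ¬? (x ≟ k)) π) + mult k π ≡ length π
  length-filter-≢-+-mult k π = begin
    length (filter (λ x → ¬? (x ≟ k)) π) + mult k π
      ≡⟨ cong₂ _+_ (length-filter-∑𝟙 (λ x → ¬? (x ≟ k)) π) (length-filter-∑𝟙 (_≟ k) π) ⟩
    ∑[ x ∈ π ] 𝟙 (¬? (x ≟ k)) + ∑[ x ∈ π ] 𝟙 (x ≟ k)
      ≡⟨ ∑∈-distrib _ _ π ⟨
    ∑[ x ∈ π ] (𝟙 (¬? (x ≟ k)) + 𝟙 (x ≟ k))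
      ≡⟨ ∑∈-cong π (λ x → 𝟙-¬ (x ≟ k)) ⟩
    ∑[ x ∈ π ] 1
      ≡⟨ ∑∈-1 π ⟩
    length π ∎
    where open ≡-Reasoning

  mult-≤ : ∀ {n} i π → IsPartition n n π → mult i π ≤ n
  mult-≤ i π (parts , total) = ≤-trans (length-filter (_≟ i) π) (≤-trans (length-≤-sum π parts) (≤-reflexive total))

  ∑-largestPart≡∑-length : ∀ n → ∑[ π ∈ partitions n ] largestPart π ≡ ∑[ π ∈ partitions n ] length π
  ∑-largestPart≡∑-length n = ∑∈-equidistributed n largestPart length (partitions n)
    (All.map (λ (parts , _) → largestPart-≤ _ parts) (partitions-sound n))
    (All.map (λ (parts , total) → ≤-trans (length-≤-sum _ parts) (≤-reflexive total)) (partitions-sound n))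
    (λ i i<n → begin
      countPartitions n n (λ π → largestPart π ≤? i)  ≡⟨ count-largestPart≤ n (<⇒≤ i<n) ⟩
      p i n                                           ≡⟨ pBox-tall i ≤-refl ⟨
      pBox i n n                                      ≡⟨ pBox-sym i n n ⟩
      pBox n i n                                      ≡⟨ count-length≤ n i n ⟨
      countPartitions n n (λ π → length π ≤? i)       ∎)
    where open ≡-Reasoning

  νD<≡partsNot : ∀ {k} → 0 < k → ∀ n → νD< k n ≡ partsNot k n
  νD<≡partsNot {k} 0<k n = +-cancelʳ-≡ _ (νD< k n) (partsNot k n) (begin
    νD< k n + ∑[ i < n ] countPartitions n n (λ π → k ≤? mult (suc i) π)
      ≡⟨ cong (νD< k n +_) (∑∈-∑<-comm (λ π i → 𝟙 (k ≤? mult (suc i) π)) n (partitions n)) ⟨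
    νD< k n + ∑[ π ∈ partitions n ] ∑[ i < n ] 𝟙 (k ≤? mult (suc i) π)
      ≡⟨ ∑∈-distrib (νd< k) _ (partitions n) ⟨
    ∑[ π ∈ partitions n ] (νd< k π + ∑[ i < n ] 𝟙 (k ≤? mult (suc i) π))
      ≡⟨ ∑∈-cong-local (partitions-sound n) (λ π (parts , _) → νd<-+-#mult≥ 0<k π parts) ⟩
    ∑[ π ∈ partitions n ] largestPart π
      ≡⟨ ∑-largestPart≡∑-length n ⟩
    ∑[ π ∈ partitions n ] length π
      ≡⟨ ∑∈-cong (partitions n) (length-filter-≢-+-mult k) ⟨
    ∑[ π ∈ partitions n ] (length (filter (λ x → ¬? (x ≟ k)) π) + mult k π)
      ≡⟨ ∑∈-distrib (λ π → length (filter (λ x → ¬? (x ≟ k)) π)) (mult k) (partitions n) ⟩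
    partsNot k n + ∑[ π ∈ partitions n ] mult k π
      ≡⟨ cong (partsNot k n +_) (∑∈-cong-local (partitions-sound n) (λ π π⊢n → ∑<-𝟙-< (mult-≤ k π π⊢n))) ⟨
    partsNot k n + ∑[ π ∈ partitions n ] ∑[ i < n ] 𝟙 (i <? mult k π)
      ≡⟨ cong (partsNot k n +_) (∑∈-∑<-comm (λ π i → 𝟙 (i <? mult k π)) n (partitions n)) ⟩
    partsNot k n + ∑[ i < n ] countPartitions n n (λ π → suc i ≤? mult k π)
      ≡⟨ cong (partsNot k n +_) (∑<-cong n (λ i _ → mult-count-sym i)) ⟨
    partsNot k n + ∑[ i < n ] countPartitions n n (λ π → k ≤? mult (suc i) π)  ∎)
    where
      open ≡-Reasoning
      mult-count-sym : ∀ i → countPartitions n n (λ π → k ≤? mult (suc i) π)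
                           ≡ countPartitions n n (λ π → suc i ≤? mult k π)
      mult-count-sym i = begin
        countPartitions n n (λ π → k ≤? mult (suc i) π)
          ≡⟨ count-mult≥-partitions k n (s≤s z≤n) ⟩
        shift (k * suc i) (p n) n
          ≡⟨ cong (λ s → shift s (p n) n) (*-comm k (suc i)) ⟩
        shift (suc i * k) (p n) n
          ≡⟨ count-mult≥-partitions (suc i) n 0<k ⟨
        countPartitions n n (λ π → suc i ≤? mult k π) ∎

  ∑≢-𝟙-≟ : ∀ k {n y} → 0 < y → y ≤ n → ∑≢ k n (λ m → 𝟙 (y ≟ m)) ≡ 𝟙 (¬? (y ≟ k))
  ∑≢-𝟙-≟ k {n} {suc y} _ y<n =
    trans (∑<-single n y _ y<n (λ i i≢y →
             unless-0 (does (suc i ≟ k)) (𝟙-no (suc y ≟ suc i) (i≢y ∘ sym ∘ suc-injective))))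
          (unless-𝟙 (suc y ≟ k))
    where
      unless-0 : ∀ b {x} → x ≡ 0 → (if b then 0 else x) ≡ 0
      unless-0 true  _   = refl
      unless-0 false x≡0 = x≡0
      unless-𝟙 : ∀ {P : Set} (d : Dec P) → (if does d then 0 else 𝟙 (suc y ≟ suc y)) ≡ 𝟙 (¬? d)
      unless-𝟙 (yes _) = refl
      unless-𝟙 (no _)  = 𝟙-yes (suc y ≟ suc y) refl

  length-filter-≢-as-∑≢ : ∀ k {n} π → PartsIn n π →
                          length (filter (λ x → ¬? (x ≟ k)) π) ≡ ∑≢ k n (λ m → mult m π)
  length-filter-≢-as-∑≢ k {n} π parts = begin
    length (filter (λ x → ¬? (x ≟ k)) π)
      ≡⟨ length-filter-∑𝟙 (λ x → ¬? (x ≟ k)) π ⟩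
    ∑[ y ∈ π ] 𝟙 (¬? (y ≟ k))
      ≡⟨ ∑∈-cong-local parts (λ y (0<y , y≤n) → ∑≢-𝟙-≟ k 0<y y≤n) ⟨
    ∑[ y ∈ π ] ∑≢ k n (λ m → 𝟙 (y ≟ m))
      ≡⟨ ∑∈-∑≢-comm k n (λ y m → 𝟙 (y ≟ m)) π ⟩
    ∑≢ k n (λ m → ∑[ y ∈ π ] 𝟙 (y ≟ m))
      ≡⟨ ∑≢-cong k n (λ m _ _ → length-filter-∑𝟙 (_≟ m) π) ⟨
    ∑≢ k n (λ m → mult m π) ∎
    where open ≡-Reasoning

  partsNot≡Λ : ∀ k {N} x → x ≤ N → partsNot k x ≡ Λ k N p∞ x
  partsNot≡Λ k {N} x x≤N = begin
    ∑[ π ∈ partitions x ] length (filter (λ y → ¬? (y ≟ k)) π)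
      ≡⟨ ∑∈-cong-local (partitions-sound x) (λ π (parts , _) → length-filter-≢-as-∑≢ k π parts) ⟩
    ∑[ π ∈ partitions x ] ∑≢ k x (λ m → mult m π)
      ≡⟨ ∑∈-cong-local (partitions-sound x) (λ π π⊢x → ∑≢-cong k x (λ m _ _ → ∑<-𝟙-< (mult-≤ m π π⊢x))) ⟨
    ∑[ π ∈ partitions x ] ∑≢ k x (λ m → ∑[ r < x ] 𝟙 (r <? mult m π))
      ≡⟨ ∑∈-∑≢-comm k x (λ π m → ∑[ r < x ] 𝟙 (r <? mult m π)) (partitions x) ⟩
    ∑≢ k x (λ m → ∑[ π ∈ partitions x ] ∑[ r < x ] 𝟙 (r <? mult m π))
      ≡⟨ ∑≢-cong k x (λ m _ _ → ∑∈-∑<-comm (λ π r → 𝟙 (r <? mult m π)) x (partitions x)) ⟩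
    ∑≢ k x (λ m → ∑[ r < x ] countPartitions x x (λ π → suc r ≤? mult m π))
      ≡⟨ ∑≢-cong k x (λ m 0<m _ → ∑<-cong x (λ r _ → count-mult≥-partitions (suc r) x 0<m)) ⟩
    ∑≢ k x (λ m → ∑[ r < x ] shift (suc r * m) (p x) x)
      ≡⟨ ∑≢-cong k x (λ m _ _ → ∑<-cong x (λ r _ →
           shift-cong (suc r * m) x {p x} {p∞} (λ _ → p-stable (m∸n≤m x (suc r * m))))) ⟩
    Λ k x p∞ x
      ≡⟨ Λ-truncate k p∞ x≤N ⟨
    Λ k N p∞ x ∎
    where open ≡-Reasoning

  shift-δ : ∀ s n → shift s δ n ≡ 𝟙 (s ≟ n)
  shift-δ s n with s ≤? n
  ... | no s≰n = sym (𝟙-no (s ≟ n) (s≰n ∘ ≤-reflexive))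
  ... | yes s≤n with n ∸ s in n∸s≡
  ...   | zero  = sym (𝟙-yes (s ≟ n) (≤-antisym s≤n (m∸n≡0⇒m≤n n∸s≡)))
  ...   | suc _ = sym (𝟙-no (s ≟ n) (λ { refl → 0≢1+n (trans (sym (n∸n≡0 s)) n∸s≡) }))

  ∑<-𝟙-multiple : ∀ {m n} → 0 < m → m ≤ n → ∑[ r < n ] 𝟙 (suc r * m ≟ n) ≡ 𝟙 (m ∣? n)
  ∑<-𝟙-multiple {m} {n} 0<m m≤n with m ∣? n
  ... | no m∤n = ∑<-zero n (λ r _ → 𝟙-no (suc r * m ≟ n) (λ rm≡n → m∤n (divides (suc r) (sym rm≡n))))
  ... | yes (divides zero n≡0) = contradiction (subst (m ≤_) n≡0 m≤n) (<⇒≱ 0<m)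
  ... | yes (divides (suc q) n≡qm) =
    trans (∑<-single n q _ q<n (λ r r≢q → 𝟙-no (suc r * m ≟ n) (λ rm≡n → r≢q (same-quotient (trans rm≡n n≡qm)))))
          (𝟙-yes (suc q * m ≟ n) (sym n≡qm))
    where
      same-quotient : ∀ {r} → suc r * m ≡ suc q * m → r ≡ q
      same-quotient eq = suc-injective (*-cancelʳ-≡ _ _ m {{>-nonZero 0<m}} eq)
      q<n : q < n
      q<n = subst (q <_) (sym n≡qm) (≤-trans (n<1+n q) (m≤m*n (suc q) m {{>-nonZero 0<m}}))

  𝟙-¬-×-dec : ∀ {P Q : Set} (p : Dec P) (q : Dec Q) → 𝟙 (¬? p ×-dec q) ≡ (if does p then 0 else 𝟙 q)
  𝟙-¬-×-dec (yes _) q = refl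
  𝟙-¬-×-dec (no _)  q = refl

  Λ-δ : ∀ k n → Λ k n δ n ≡ length (filter (λ m → ¬? (m ≟ k) ×-dec (m ∣? n)) (map suc (upTo n)))
  Λ-δ k n = begin
    ∑≢ k n (λ m → ∑[ r < n ] shift (suc r * m) δ n)
      ≡⟨ ∑≢-cong k n (λ m 0<m m≤n →
           trans (∑<-cong n (λ r _ → shift-δ (suc r * m) n)) (∑<-𝟙-multiple 0<m m≤n)) ⟩
    ∑≢ k n (λ m → 𝟙 (m ∣? n))
      ≡⟨ ∑<-cong n (λ i _ → 𝟙-¬-×-dec (suc i ≟ k) (suc i ∣? n)) ⟨
    ∑[ i < n ] 𝟙 (¬? (suc i ≟ k) ×-dec (suc i ∣? n))
      ≡⟨ ∑∈-applyUpTo (λ m → 𝟙 (¬? (m ≟ k) ×-dec (m ∣? n))) suc n ⟨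
    ∑[ m ∈ applyUpTo suc n ] 𝟙 (¬? (m ≟ k) ×-dec (m ∣? n))
      ≡⟨ cong (λ ms → ∑[ m ∈ ms ] 𝟙 (¬? (m ≟ k) ×-dec (m ∣? n))) (map-upTo suc n) ⟨
    ∑[ m ∈ map suc (upTo n) ] 𝟙 (¬? (m ≟ k) ×-dec (m ∣? n))
      ≡⟨ length-filter-∑𝟙 (λ m → ¬? (m ≟ k) ×-dec (m ∣? n)) (map suc (upTo n)) ⟨
    length (filter (λ m → ¬? (m ≟ k) ×-dec (m ∣? n)) (map suc (upTo n))) ∎
    where open ≡-Reasoning

module GeneratingFunction where

  open import Data.Bool using (if_then_else_)
  open import Data.Integer using (ℤ; +_; -_; _+_; _*_; -1ℤ)
  import Data.Integer.Properties as ℤP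
  open import Data.List using (upTo)
  open import Data.Nat as ℕ using (zero; suc; _∸_; _<_; z≤n; s≤s; _≤?_; _≟_)
  import Data.Nat.Properties as ℕP
  open import Function using (_∘_)
  open import Relation.Nullary using (Dec; yes; no)
  open import Relation.Nullary.Decidable using (dec-true; dec-false)
  open import Algebra.Properties.AbelianGroup ℤP.+-0-abelianGroup using (∙-cancelʳ)

  open Counting using (p; p∞; p-suc; p-stable; δ; Λ-δ; partsNot≡Λ; νD<≡partsNot)

  module ℤ-Sums = CommutativeMonoidSums ℤP.+-0-isCommutativeMonoid
  open ℤ-Sums
  open ℤ-Sums public using (Λ; Λ-cong)
  open SumHomomorphism ℕP.+-0-isCommutativeMonoid ℤP.+-0-isCommutativeMonoid +_ refl ℤP.pos-+
    using (Λ-hom; shift-hom)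

  module Scaling (c : ℤ) =
    SumHomomorphism ℤP.+-0-isCommutativeMonoid ℤP.+-0-isCommutativeMonoid (c *_) (ℤP.*-zeroʳ c) (ℤP.*-distribˡ-+ c)

  ⊛-as-∑< : ∀ a b n → (a ⊛ b) n ≡ ∑[ j < suc n ] (a j * b (n ∸ j))
  ⊛-as-∑< a b n = ∑∈-applyUpTo (λ j → a j * b (n ∸ j)) (λ j → j) (suc n)

  ⊛-comm : ∀ a b n → (a ⊛ b) n ≡ (b ⊛ a) n
  ⊛-comm a b n = begin
    (a ⊛ b) n
      ≡⟨ ⊛-as-∑< a b n ⟩
    ∑[ j < suc n ] (a j * b (n ∸ j))
      ≡⟨ ∑<-reverse n (λ j → a j * b (n ∸ j)) ⟩
    ∑[ j < suc n ] (a (n ∸ j) * b (n ∸ (n ∸ j)))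
      ≡⟨ ∑<-cong (suc n) (λ j j≤n → trans (cong (λ i → a (n ∸ j) * b i) (ℕP.m∸[m∸n]≡n (ℕP.≤-pred j≤n)))
                                          (ℤP.*-comm (a (n ∸ j)) (b j))) ⟩
    ∑[ j < suc n ] (b j * a (n ∸ j))
      ≡⟨ ⊛-as-∑< b a n ⟨
    (b ⊛ a) n ∎
    where open ≡-Reasoning

  ⊛-congˡ : ∀ {a a′} b n → (∀ j → j ≤ n → a j ≡ a′ j) → (a ⊛ b) n ≡ (a′ ⊛ b) n
  ⊛-congˡ {a} {a′} b n a≡a′ = begin
    (a ⊛ b) n
      ≡⟨ ⊛-as-∑< a b n ⟩
    ∑[ j < suc n ] (a j * b (n ∸ j))
      ≡⟨ ∑<-cong (suc n) (λ j j≤n → cong (_* b (n ∸ j)) (a≡a′ j (ℕP.≤-pred j≤n))) ⟩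
    ∑[ j < suc n ] (a′ j * b (n ∸ j))
      ≡⟨ ⊛-as-∑< a′ b n ⟨
    (a′ ⊛ b) n ∎
    where open ≡-Reasoning

  ⊛-congʳ : ∀ a {b b′} n → (∀ j → j ≤ n → b j ≡ b′ j) → (a ⊛ b) n ≡ (a ⊛ b′) n
  ⊛-congʳ a {b} {b′} n b≡b′ = trans (⊛-comm a b n) (trans (⊛-congˡ a n b≡b′) (⊛-comm b′ a n))

  ⊛-distribˡ-+ : ∀ a b c n → (a ⊛ (λ x → b x + c x)) n ≡ (a ⊛ b) n + (a ⊛ c) n
  ⊛-distribˡ-+ a b c n =
    trans (∑∈-cong (upTo (suc n)) (λ j → ℤP.*-distribˡ-+ (a j) (b (n ∸ j)) (c (n ∸ j))))
          (∑∈-distrib (λ j → a j * b (n ∸ j)) (λ j → a j * c (n ∸ j)) (upTo (suc n)))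

  ⊛-∑<ʳ : ∀ a N (F : ℕ → ℕ → ℤ) n → (a ⊛ (λ x → ∑[ r < N ] F r x)) n ≡ ∑[ r < N ] (a ⊛ F r) n
  ⊛-∑<ʳ a N F n =
    trans (∑∈-cong (upTo (suc n)) (λ j → Scaling.∑<-hom (a j) N (λ r → F r (n ∸ j))))
          (∑∈-∑<-comm (λ j r → a j * F r (n ∸ j)) N (upTo (suc n)))

  ⊛-∑≢ʳ : ∀ a k N (F : ℕ → ℕ → ℤ) n → (a ⊛ (λ x → ∑≢ k N (λ m → F m x))) n ≡ ∑≢ k N (λ m → (a ⊛ F m) n)
  ⊛-∑≢ʳ a k N F n =
    trans (∑∈-cong (upTo (suc n)) (λ j → Scaling.∑≢-hom (a j) k N (λ m → F m (n ∸ j))))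
          (∑∈-∑≢-comm k N (λ j m → a j * F m (n ∸ j)) (upTo (suc n)))

  ⊛-shiftʳ : ∀ a s b n → (a ⊛ shift s b) n ≡ shift s (a ⊛ b) n
  ⊛-shiftʳ a s b n = by-cases (s ≤? n)
    where
      by-cases : Dec (s ≤ n) → (a ⊛ shift s b) n ≡ shift s (a ⊛ b) n
      by-cases (no s≰n) = begin
        (a ⊛ shift s b) n
          ≡⟨ ⊛-as-∑< a (shift s b) n ⟩
        ∑[ j < suc n ] (a j * shift s b (n ∸ j))
          ≡⟨ ∑<-zero (suc n) (λ j _ → trans (cong (a j *_) (shift-≰ b (s≰n ∘ (λ s≤n∸j → ℕP.≤-trans s≤n∸j (ℕP.m∸n≤m n j)))))
                                             (ℤP.*-zeroʳ (a j))) ⟩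
        + 0
          ≡⟨ shift-≰ (a ⊛ b) s≰n ⟨
        shift s (a ⊛ b) n ∎
        where open ≡-Reasoning
      by-cases (yes s≤n) = begin
        (a ⊛ shift s b) n
          ≡⟨ ⊛-as-∑< a (shift s b) n ⟩
        ∑[ j < suc n ] (a j * shift s b (n ∸ j))
          ≡⟨ ∑<-truncate _ (s≤s (ℕP.m∸n≤m n s)) (λ j n∸s<j j<1+n →
               trans (cong (a j *_) (shift-≰ b (ℕP.<⇒≱ n∸s<j ∘ j≤n∸s (ℕP.≤-pred j<1+n)))) (ℤP.*-zeroʳ (a j))) ⟩
        ∑[ j < suc (n ∸ s) ] (a j * shift s b (n ∸ j))
          ≡⟨ ∑<-cong (suc (n ∸ s)) (λ j j<1+n∸s →
               cong (a j *_) (trans (shift-≤ b (s≤n∸j (ℕP.≤-pred j<1+n∸s))) (cong b (∸-comm n j s)))) ⟩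
        ∑[ j < suc (n ∸ s) ] (a j * b (n ∸ s ∸ j))
          ≡⟨ ⊛-as-∑< a b (n ∸ s) ⟨
        (a ⊛ b) (n ∸ s)
          ≡⟨ shift-≤ (a ⊛ b) s≤n ⟨
        shift s (a ⊛ b) n ∎
        where
          open ≡-Reasoning
          ∸-comm : ∀ n j s → n ∸ j ∸ s ≡ n ∸ s ∸ j
          ∸-comm n j s = trans (ℕP.∸-+-assoc n j s) (trans (cong (n ∸_) (ℕP.+-comm j s)) (sym (ℕP.∸-+-assoc n s j)))
          j≤n∸s : ∀ {j} → j ≤ n → s ≤ n ∸ j → j ≤ n ∸ s
          j≤n∸s j≤n s≤n∸j = subst (_≤ n ∸ s) (ℕP.m∸[m∸n]≡n j≤n) (ℕP.∸-monoʳ-≤ n s≤n∸j)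
          s≤n∸j : ∀ {j} → j ≤ n ∸ s → s ≤ n ∸ j
          s≤n∸j {j} j≤n∸s = subst (_≤ n ∸ j) (ℕP.m∸[m∸n]≡n s≤n) (ℕP.∸-monoʳ-≤ n j≤n∸s)

  ⊛-Λʳ : ∀ a k N f n → (a ⊛ Λ k N f) n ≡ Λ k N (a ⊛ f) n
  ⊛-Λʳ a k N f n = begin
    (a ⊛ Λ k N f) n
      ≡⟨ ⊛-∑≢ʳ a k N (λ m x → ∑[ r < N ] shift (suc r ℕ.* m) f x) n ⟩
    ∑≢ k N (λ m → (a ⊛ (λ x → ∑[ r < N ] shift (suc r ℕ.* m) f x)) n)
      ≡⟨ ∑≢-cong k N (λ m _ _ → ⊛-∑<ʳ a N (λ r → shift (suc r ℕ.* m) f) n) ⟩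
    ∑≢ k N (λ m → ∑[ r < N ] (a ⊛ shift (suc r ℕ.* m) f) n)
      ≡⟨ ∑≢-cong k N (λ m _ _ → ∑<-cong N (λ r _ → ⊛-shiftʳ a (suc r ℕ.* m) f n)) ⟩
    Λ k N (a ⊛ f) n  ∎
    where open ≡-Reasoning

  oneS-⊛ : ∀ b n → (oneS ⊛ b) n ≡ b n
  oneS-⊛ b n = begin
    (oneS ⊛ b) n
      ≡⟨ ⊛-as-∑< oneS b n ⟩
    + 1 * b n + ∑[ j < n ] (+ 0 * b (n ∸ suc j))
      ≡⟨ cong₂ _+_ (ℤP.*-identityˡ (b n)) (∑<-zero n (λ j _ → ℤP.*-zeroˡ (b (n ∸ suc j)))) ⟩
    b n + + 0
      ≡⟨ ℤP.+-identityʳ (b n) ⟩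
    b n ∎
    where open ≡-Reasoning

  oneMinusQ-≡ : ∀ i → oneMinusQ (suc i) (suc i) ≡ -1ℤ
  oneMinusQ-≡ i = cong (λ b → if b then -1ℤ else + 0) (dec-true (suc i ≟ suc i) refl)

  oneMinusQ-≢ : ∀ {i j} → suc j ≢ i → oneMinusQ i (suc j) ≡ + 0
  oneMinusQ-≢ {i} {j} j≢i = cong (λ b → if b then -1ℤ else + 0) (dec-false (suc j ≟ i) j≢i)

  ⊛-oneMinusQ : ∀ a d n → a n ≡ (a ⊛ oneMinusQ (suc d)) n + shift (suc d) a n
  ⊛-oneMinusQ a d n = sym (begin
    (a ⊛ oneMinusQ (suc d)) n + shift (suc d) a n
      ≡⟨ cong (_+ shift (suc d) a n) (trans (⊛-comm a (oneMinusQ (suc d)) n) (⊛-as-∑< (oneMinusQ (suc d)) a n)) ⟩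
    (+ 1 * a n + ∑[ t < n ] (oneMinusQ (suc d) (suc t) * a (n ∸ suc t))) + shift (suc d) a n
      ≡⟨ cong (λ z → (z + ∑[ t < n ] (oneMinusQ (suc d) (suc t) * a (n ∸ suc t))) + shift (suc d) a n)
              (ℤP.*-identityˡ (a n)) ⟩
    (a n + ∑[ t < n ] (oneMinusQ (suc d) (suc t) * a (n ∸ suc t))) + shift (suc d) a n
      ≡⟨ cong (λ z → (a n + z) + shift (suc d) a n) (by-cases (suc d ≤? n)) ⟩
    (a n + - shift (suc d) a n) + shift (suc d) a n
      ≡⟨ ℤP.+-assoc (a n) _ _ ⟩
    a n + (- shift (suc d) a n + shift (suc d) a n)
      ≡⟨ cong (λ z → a n + z) (ℤP.+-inverseˡ (shift (suc d) a n)) ⟩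
    a n + + 0
      ≡⟨ ℤP.+-identityʳ (a n) ⟩
    a n  ∎)
    where
      open ≡-Reasoning
      term-vanishes : ∀ t → t ≢ d → oneMinusQ (suc d) (suc t) * a (n ∸ suc t) ≡ + 0
      term-vanishes t t≢d = trans (cong (_* a (n ∸ suc t)) (oneMinusQ-≢ (t≢d ∘ ℕP.suc-injective)))
                                  (ℤP.*-zeroˡ (a (n ∸ suc t)))
      by-cases : Dec (suc d ≤ n) → ∑[ t < n ] (oneMinusQ (suc d) (suc t) * a (n ∸ suc t)) ≡ - shift (suc d) a n
      by-cases (yes d<n) = begin
        ∑[ t < n ] (oneMinusQ (suc d) (suc t) * a (n ∸ suc t))
          ≡⟨ ∑<-single n d _ d<n term-vanishes ⟩
        oneMinusQ (suc d) (suc d) * a (n ∸ suc d)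
          ≡⟨ cong (_* a (n ∸ suc d)) (oneMinusQ-≡ d) ⟩
        -1ℤ * a (n ∸ suc d)
          ≡⟨ ℤP.-1*i≡-i (a (n ∸ suc d)) ⟩
        - a (n ∸ suc d)
          ≡⟨ cong -_ (shift-≤ a d<n) ⟨
        - shift (suc d) a n ∎
      by-cases (no d≮n) = begin
        ∑[ t < n ] (oneMinusQ (suc d) (suc t) * a (n ∸ suc t))
          ≡⟨ ∑<-zero n (λ t t<n → term-vanishes t (λ { refl → d≮n t<n })) ⟩
        + 0
          ≡⟨ cong -_ (shift-≰ a d≮n) ⟨
        - shift (suc d) a n ∎

  finProd-stable : ∀ {N j} → j ≤ N → finProd N j ≡ qqInf j
  finProd-stable {zero}  z≤n = refl
  finProd-stable {suc N} {j} j≤N with j ℕ.≟ suc N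
  ... | yes refl = refl
  ... | no  j≢N  = begin
    finProd (suc N) j
      ≡⟨ ℤP.+-identityʳ _ ⟨
    finProd (suc N) j + + 0
      ≡⟨ cong (λ z → finProd (suc N) j + z) (shift-≰ (finProd N) (ℕP.<⇒≱ j<1+N)) ⟨
    (finProd N ⊛ oneMinusQ (suc N)) j + shift (suc N) (finProd N) j
      ≡⟨ ⊛-oneMinusQ (finProd N) N j ⟨
    finProd N j
      ≡⟨ finProd-stable (ℕP.≤-pred j<1+N) ⟩
    qqInf j ∎
    where
      open ≡-Reasoning
      j<1+N = ℕP.≤∧≢⇒< j≤N j≢N

  finProd-⊛-p : ∀ M n → (finProd M ⊛ (+_ ∘ p M)) n ≡ oneS n
  finProd-⊛-p zero n = trans (oneS-⊛ (+_ ∘ p 0) n) (p₀ n)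
    where
      p₀ : ∀ n → + p 0 n ≡ oneS n
      p₀ zero    = refl
      p₀ (suc n) = refl
  finProd-⊛-p (suc M) n =
    trans (⊛-comm (F ⊛ O) Q n) (∙-cancelʳ (shift d (Q ⊛ F) n) ((Q ⊛ (F ⊛ O)) n) (oneS n) (begin
    (Q ⊛ (F ⊛ O)) n + shift d (Q ⊛ F) n
      ≡⟨ cong (λ z → (Q ⊛ (F ⊛ O)) n + z) (⊛-shiftʳ Q d F n) ⟨
    (Q ⊛ (F ⊛ O)) n + (Q ⊛ shift d F) n
      ≡⟨ ⊛-distribˡ-+ Q (F ⊛ O) (shift d F) n ⟨
    (Q ⊛ (λ x → (F ⊛ O) x + shift d F x)) n ≡⟨ ⊛-congʳ Q n (λ x _ → ⊛-oneMinusQ F M x) ⟨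
    (Q ⊛ F) n
      ≡⟨ ⊛-comm Q F n ⟩
    (F ⊛ Q) n
      ≡⟨ ⊛-congʳ F n (λ x _ → trans (cong +_ (p-suc M x)) (cong (λ z → + p M x + z) (shift-hom d (p d) x))) ⟩
    (F ⊛ (λ x → + p M x + shift d Q x)) n
      ≡⟨ ⊛-distribˡ-+ F (+_ ∘ p M) (shift d Q) n ⟩
    (F ⊛ (+_ ∘ p M)) n + (F ⊛ shift d Q) n
      ≡⟨ cong₂ _+_ (finProd-⊛-p M n) (⊛-shiftʳ F d Q n) ⟩
    oneS n + shift d (F ⊛ Q) n
      ≡⟨ cong (λ z → oneS n + z) (shift-cong d n (λ _ → ⊛-comm F Q (n ∸ d))) ⟩
    oneS n + shift d (Q ⊛ F) n              ∎))
    where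
      open ≡-Reasoning
      d = suc M
      F = finProd M
      O = oneMinusQ d
      Q = +_ ∘ p d

  partitionSeries : Series
  partitionSeries n = + p∞ n

  euler : ∀ n → (qqInf ⊛ partitionSeries) n ≡ oneS n
  euler n = begin
    (qqInf ⊛ partitionSeries) n
      ≡⟨ ⊛-congˡ partitionSeries n (λ j j≤n → sym (finProd-stable j≤n)) ⟩
    (finProd n ⊛ partitionSeries) n ≡⟨ ⊛-congʳ (finProd n) n (λ x x≤n → cong +_ (sym (p-stable x≤n))) ⟩
    (finProd n ⊛ (+_ ∘ p n)) n
      ≡⟨ finProd-⊛-p n n ⟩
    oneS n ∎
    where open ≡-Reasoning

  νDSeries≡Λ : ∀ {k} → 0 < k → ∀ {n x} → x ≤ n → νDSeries k x ≡ Λ k n partitionSeries x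
  νDSeries≡Λ {k} 0<k {n} {x} x≤n = begin
    + νD< k x                ≡⟨ cong +_ (νD<≡partsNot 0<k x) ⟩
    + partsNot k x           ≡⟨ cong +_ (partsNot≡Λ k x x≤n) ⟩
    + Counting.Λ k n p∞ x  ≡⟨ Λ-hom k n p∞ x ⟩
    Λ k n partitionSeries x  ∎
    where open ≡-Reasoning

  Λ-oneS : ∀ k n → Λ k n oneS n ≡ lambertNot k n
  Λ-oneS k n = begin
    Λ k n oneS n            ≡⟨ Λ-cong k n oneS≡δ n ⟩
    Λ k n (+_ ∘ δ) n        ≡⟨ Λ-hom k n δ n ⟨
    + Counting.Λ k n δ n  ≡⟨ cong +_ (Λ-δ k n) ⟩
    lambertNot k n          ∎
    where
      open ≡-Reasoning
      oneS≡δ : ∀ y → oneS y ≡ + δ y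
      oneS≡δ zero    = refl
      oneS≡δ (suc y) = refl

open Counting using (νD<≡partsNot)
open GeneratingFunction

theorem2p9 : (k : ℕ) → 1 ≤ k →
    ((n : ℕ) → (qqInf ⊛ νDSeries k) n ≡ lambertNot k n)
    × ((n : ℕ) → νD< k n ≡ partsNot k n)
theorem2p9 k 0<k = generatingFunction , νD<≡partsNot 0<k
  where
    generatingFunction : ∀ n → (qqInf ⊛ νDSeries k) n ≡ lambertNot k n
    generatingFunction n = begin
      (qqInf ⊛ νDSeries k) n           ≡⟨ ⊛-congʳ qqInf n (λ _ → νDSeries≡Λ 0<k) ⟩
      (qqInf ⊛ Λ k n partitionSeries) n ≡⟨ ⊛-Λʳ qqInf k n partitionSeries n ⟩
      Λ k n (qqInf ⊛ partitionSeries) n ≡⟨ Λ-cong k n euler n ⟩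
      Λ k n oneS n                     ≡⟨ Λ-oneS k n ⟩
      lambertNot k n                   ∎
      where open ≡-Reasoning
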